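{- Let $p$ and $q$ be degree sequences. If some realization of $p$ is (isomorphic to) an induced subgraph of some realization of $q$, then $\mathscr{G}(p)$ is isomorphic to an induced subgraph of $\mathscr{G}(q)$.
   Context: All graphs are finite and simple. For a degree sequence $d=(d_1,\dots,d_n)$, a realization of $d$ is a graph with vertex set $\{1,\dots,n\}$ in which vertex $i$ has degree $d_i$ (realizations are distinguished by edge sets). A 2-switch in a graph replaces edges $ab,cd$ by $ad,bc$, where $a,b,c,d$ are distinct, $ab,cd$ are edges and $ad,bc$ are non-edges. The realization graph $\mathscr{G}(d)$ has the realizations of $d$ as vertices, two being adjacent iff one is obtained from the other by a single 2-switch. -}

module Defs where

open import Data.Nat using (ℕ)
open import Data.Bool using (Bool; true; false; _∧_; _∨_; if_then_else_)
open import Data.Fin using (Fin; _≟_)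
open import Data.Vec using (Vec; lookup; count)
open import Data.Product using (Σ; ∃; ∃-syntax; _×_; proj₁)
open import Data.Sum using (_⊎_)
open import Relation.Nullary using (¬_; does)
open import Relation.Binary.PropositionalEquality using (_≡_)
open import Function using (_⇔_)

-- A (labelled) graph on vertex set Fin n, given by its adjacency matrix.
-- Two graphs are equal iff they have the same adjacency matrix (= same edge set
-- once simplicity holds).
Graph : ℕ → Set
Graph n = Vec (Vec Bool n) n

adj : ∀ {n} → Graph n → Fin n → Fin n → Bool
adj A i j = lookup (lookup A i) j

IsSimple : ∀ {n} → Graph n → Set
IsSimple {n} A = (∀ i j → adj A i j ≡ adj A j i) × (∀ i → adj A i i ≡ false)

deg : ∀ {n} → Graph n → Fin n → ℕ
deg A i = count (λ b → Data.Bool._≟_ b true) (lookup A i)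
  where import Data.Bool

IsRealization : ∀ {n} → Vec ℕ n → Graph n → Set
IsRealization {n} d A = IsSimple A × (∀ i → deg A i ≡ lookup d i)

Realization : ∀ {n} → Vec ℕ n → Set
Realization {n} d = Σ (Graph n) (IsRealization d)

samePair : ∀ {n} → Fin n → Fin n → Fin n → Fin n → Bool
samePair a b x y = (does (x ≟ a) ∧ does (y ≟ b)) ∨ (does (x ≟ b) ∧ does (y ≟ a))

switchAdj : ∀ {n} → Graph n → Fin n → Fin n → Fin n → Fin n → Fin n → Fin n → Bool
switchAdj A a b c d x y =
  if samePair a b x y ∨ samePair c d x y then false
  else if samePair a d x y ∨ samePair b c x y then true
  else adj A x y

Distinct4 : ∀ {n} → Fin n → Fin n → Fin n → Fin n → Set
Distinct4 a b c d =
  ¬ a ≡ b × ¬ a ≡ c × ¬ a ≡ d × ¬ b ≡ c × ¬ b ≡ d × ¬ c ≡ d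

TwoSwitch : ∀ {n} → Graph n → Graph n → Set
TwoSwitch {n} G H = ∃[ a ] ∃[ b ] ∃[ c ] ∃[ d ]
  ( Distinct4 a b c d
  × adj G a b ≡ true × adj G c d ≡ true
  × adj G a d ≡ false × adj G b c ≡ false
  × (∀ x y → adj H x y ≡ switchAdj G a b c d x y))

RGAdj : ∀ {n} {d : Vec ℕ n} → Realization d → Realization d → Set
RGAdj R S = TwoSwitch (proj₁ R) (proj₁ S) ⊎ TwoSwitch (proj₁ S) (proj₁ R)

InducedSubgraphOf : ∀ {m n} → Graph m → Graph n → Set
InducedSubgraphOf {m} {n} G H = Σ (Fin m → Fin n) λ φ →
  (∀ i j → φ i ≡ φ j → i ≡ j) × (∀ i j → adj G i j ≡ adj H (φ i) (φ j))

-- 𝒢(p) is isomorphic to an induced subgraph of 𝒢(q): an injective map on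
-- realizations (vertices equal iff same graph) preserving and reflecting adjacency.
RGInducedSubgraphOf : ∀ {m n} → Vec ℕ m → Vec ℕ n → Set
RGInducedSubgraphOf p q = Σ (Realization p → Realization q) λ F →
  (∀ R S → proj₁ (F R) ≡ proj₁ (F S) → proj₁ R ≡ proj₁ S)
  × (∀ R S → RGAdj {d = p} R S ⇔ RGAdj {d = q} (F R) (F S))

-- Fix a realization G of p embedded by φ as an induced subgraph of a realization H of q.
-- Send each realization R of p to the graph obtained from H by replacing the induced
-- subgraph on the image of φ by a copy of R. A vertex outside the image keeps its
-- H-neighbourhood; a vertex φ k trades its G-neighbours for its R-neighbours, and both
-- number p_k, so the new graph realizes q. R is recovered on the image, so the map is
-- injective. Two grafted graphs differ only on pairs inside the image, so a 2-switch
-- between them only touches image vertices and is the image of a 2-switch between the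
-- originals; conversely 2-switches transport along φ.
module Submission where

open import Defs
open import Data.Bool using (Bool; true; false)
import Data.Bool as Bool
open import Data.Bool.Properties using (∧-zeroʳ; ∨-zeroʳ)
open import Data.Empty using (⊥-elim)
open import Data.Fin using (Fin; zero; suc; _≟_)
open import Data.Fin.Properties using (any?; suc-injective; 0≢1+n)
open import Data.Nat using (ℕ; zero; suc; _+_)
open import Data.Nat.Properties using (+-assoc; +-cancelʳ-≡; +-commutativeSemigroup)
open import Algebra.Properties.CommutativeSemigroup +-commutativeSemigroup
  using (xy∙z≈xz∙y; xy∙z≈x∙zy; xy∙z≈zy∙x)
open import Data.Product using (∃; ∃-syntax; _×_; _,_; proj₁; proj₂)
open import Data.Sum as Sum using (_⊎_; inj₁; inj₂)
open import Data.Vec using (Vec; []; _∷_; lookup; tabulate; count)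
open import Data.Vec.Properties using (lookup∘tabulate; tabulate∘lookup; tabulate-cong)
open import Data.Vec.Functional using (updateAt)
open import Data.Vec.Functional.Properties using (updateAt-updates; updateAt-minimal)
open import Function using (_∘_; const; mk⇔)
open import Function.Definitions using (Injective)
open import Relation.Nullary using (¬_; does; yes; no; Dec)
open import Relation.Nullary.Decidable using (dec-true; dec-false; does-≡; map′)
open import Relation.Binary.PropositionalEquality

bit : Bool → ℕ
bit true = 1
bit false = 0

countTrue : ∀ {n} → (Fin n → Bool) → ℕ
countTrue {zero} f = 0
countTrue {suc n} f = bit (f zero) + countTrue (f ∘ suc)

countTrue-cong : ∀ {n} {f g : Fin n → Bool} → (∀ i → f i ≡ g i) → countTrue f ≡ countTrue g
countTrue-cong {zero} f≗g = refl
countTrue-cong {suc n} f≗g = cong₂ _+_ (cong bit (f≗g zero)) (countTrue-cong (f≗g ∘ suc))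

count≡countTrue : ∀ {n} (v : Vec Bool n) → count (Bool._≟ true) v ≡ countTrue (lookup v)
count≡countTrue [] = refl
count≡countTrue (true ∷ v) = cong (1 +_) (count≡countTrue v)
count≡countTrue (false ∷ v) = count≡countTrue v

deg≡countTrue : ∀ {n} (A : Graph n) i → deg A i ≡ countTrue (adj A i)
deg≡countTrue A i = count≡countTrue (lookup A i)

countTrue-updateAt : ∀ {n} (f : Fin n → Bool) j b →
  countTrue (updateAt f j (const b)) + bit (f j) ≡ countTrue f + bit b
countTrue-updateAt f zero b = xy∙z≈zy∙x (bit b) (countTrue (f ∘ suc)) (bit (f zero))
countTrue-updateAt f (suc j) b = begin
  bit (f zero) + countTrue (updateAt (f ∘ suc) j (const b)) + bit (f (suc j))
    ≡⟨ +-assoc (bit (f zero)) _ _ ⟩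
  bit (f zero) + (countTrue (updateAt (f ∘ suc) j (const b)) + bit (f (suc j)))
    ≡⟨ cong (bit (f zero) +_) (countTrue-updateAt (f ∘ suc) j b) ⟩
  bit (f zero) + (countTrue (f ∘ suc) + bit b)
    ≡⟨ +-assoc (bit (f zero)) _ _ ⟨
  bit (f zero) + countTrue (f ∘ suc) + bit b
    ∎
  where open ≡-Reasoning

Image : ∀ {m n} → (Fin m → Fin n) → Fin n → Set
Image φ y = ∃ λ k → φ k ≡ y

-- Stated additively so that it survives the induction on m, which moves one image
-- point at a time from u to v.
countTrue-agreeOffImage : ∀ {m n} {φ : Fin m → Fin n} → Injective _≡_ _≡_ φ →
  (u v : Fin n → Bool) → (∀ y → ¬ Image φ y → u y ≡ v y) →
  countTrue u + countTrue (v ∘ φ) ≡ countTrue v + countTrue (u ∘ φ)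
countTrue-agreeOffImage {zero} φ-inj u v agree =
  cong (_+ 0) (countTrue-cong λ y → agree y λ ())
countTrue-agreeOffImage {suc m} {n} {φ} φ-inj u v agree = begin
  countTrue u + (bit (v (φ zero)) + Sv)   ≡⟨ +-assoc (countTrue u) _ _ ⟨
  countTrue u + bit (v (φ zero)) + Sv     ≡⟨ cong (_+ Sv) (countTrue-updateAt u (φ zero) (v (φ zero))) ⟨
  countTrue w + bit (u (φ zero)) + Sv     ≡⟨ xy∙z≈xz∙y (countTrue w) _ _ ⟩
  countTrue w + Sv + bit (u (φ zero))     ≡⟨ cong (_+ bit (u (φ zero))) IH ⟩
  countTrue v + countTrue (w ∘ φ ∘ suc) + bit (u (φ zero))
    ≡⟨ cong (λ s → countTrue v + s + bit (u (φ zero))) (countTrue-cong w≗u-on-tail) ⟩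
  countTrue v + Su + bit (u (φ zero))     ≡⟨ xy∙z≈x∙zy (countTrue v) _ _ ⟩
  countTrue v + (bit (u (φ zero)) + Su)   ∎
  where
  open ≡-Reasoning
  Sv Su : ℕ
  Sv = countTrue (v ∘ φ ∘ suc)
  Su = countTrue (u ∘ φ ∘ suc)
  w : Fin n → Bool
  w = updateAt u (φ zero) (const (v (φ zero)))

  w≗u-on-tail : ∀ k → w (φ (suc k)) ≡ u (φ (suc k))
  w≗u-on-tail k = updateAt-minimal (φ (suc k)) (φ zero) u λ e → 0≢1+n (sym (φ-inj e))

  w-agree : ∀ y → ¬ Image (φ ∘ suc) y → w y ≡ v y
  w-agree y y∉ with y ≟ φ zero
  ... | yes refl = updateAt-updates (φ zero) u
  ... | no y≢φ0 = trans (updateAt-minimal y (φ zero) u y≢φ0) (agree y y∉φ)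
    where
    y∉φ : ¬ Image φ y
    y∉φ (zero , e) = y≢φ0 (sym e)
    y∉φ (suc k , e) = y∉ (k , e)

  IH : countTrue w + Sv ≡ countTrue v + countTrue (w ∘ φ ∘ suc)
  IH = countTrue-agreeOffImage (suc-injective ∘ φ-inj) w v w-agree

graph-ext : ∀ {n} {A B : Graph n} → (∀ i j → adj A i j ≡ adj B i j) → A ≡ B
graph-ext {A = A} {B} A≗B = trans (sym (tabulate∘lookup A)) (trans
  (tabulate-cong λ i → trans (sym (tabulate∘lookup (lookup A i)))
    (trans (tabulate-cong (A≗B i)) (tabulate∘lookup (lookup B i))))
  (tabulate∘lookup B))

adj-tabulate : ∀ {n} (f : Fin n → Fin n → Bool) i j → adj (tabulate (tabulate ∘ f)) i j ≡ f i j
adj-tabulate f i j rewrite lookup∘tabulate (tabulate ∘ f) i = lookup∘tabulate (f i) j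

deg-embedding : ∀ {m n} (G : Graph m) (H : Graph n) (φ : Fin m → Fin n) →
  (∀ i j → adj G i j ≡ adj H (φ i) (φ j)) → ∀ k → deg G k ≡ countTrue (adj H (φ k) ∘ φ)
deg-embedding G H φ embeds k = trans (deg≡countTrue G k) (countTrue-cong (embeds k))

does-≟-injective : ∀ {m n} {φ : Fin m → Fin n} → Injective _≡_ _≡_ φ →
  ∀ i j → does (φ i ≟ φ j) ≡ does (i ≟ j)
does-≟-injective {φ = φ} φ-inj i j = does-≡ (φ i ≟ φ j) (map′ (cong φ) φ-inj (i ≟ j))

samePair-map : ∀ {m n} {φ : Fin m → Fin n} → Injective _≡_ _≡_ φ →
  ∀ a b x y → samePair (φ a) (φ b) (φ x) (φ y) ≡ samePair a b x y
samePair-map φ-inj a b x y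
  rewrite does-≟-injective φ-inj x a | does-≟-injective φ-inj y b
        | does-≟-injective φ-inj x b | does-≟-injective φ-inj y a = refl

samePair-≢ˡ : ∀ {n} {a b x : Fin n} y → ¬ x ≡ a → ¬ x ≡ b → samePair a b x y ≡ false
samePair-≢ˡ {a = a} {b} {x} y x≢a x≢b
  rewrite dec-false (x ≟ a) x≢a | dec-false (x ≟ b) x≢b = refl

samePair-≢ʳ : ∀ {n} {a b y : Fin n} x → ¬ y ≡ a → ¬ y ≡ b → samePair a b x y ≡ false
samePair-≢ʳ {a = a} {b} {y} x y≢a y≢b
  rewrite dec-false (y ≟ a) y≢a | dec-false (y ≟ b) y≢b
        | ∧-zeroʳ (does (x ≟ a)) | ∧-zeroʳ (does (x ≟ b)) = refl

switchAdj-cong : ∀ {m n} (A : Graph m) (B : Graph n) a b c d x y a′ b′ c′ d′ x′ y′ →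
  samePair a b x y ≡ samePair a′ b′ x′ y′ → samePair c d x y ≡ samePair c′ d′ x′ y′ →
  samePair a d x y ≡ samePair a′ d′ x′ y′ → samePair b c x y ≡ samePair b′ c′ x′ y′ →
  adj A x y ≡ adj B x′ y′ → switchAdj A a b c d x y ≡ switchAdj B a′ b′ c′ d′ x′ y′
switchAdj-cong A B a b c d x y a′ b′ c′ d′ x′ y′ e₁ e₂ e₃ e₄ e₅ rewrite e₁ | e₂ | e₃ | e₄ | e₅ = refl

switchAdj-away : ∀ {n} (A : Graph n) a b c d x y →
  samePair a b x y ≡ false → samePair c d x y ≡ false →
  samePair a d x y ≡ false → samePair b c x y ≡ false → switchAdj A a b c d x y ≡ adj A x y
switchAdj-away A a b c d x y e₁ e₂ e₃ e₄ rewrite e₁ | e₂ | e₃ | e₄ = refl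

switchAdj-ab : ∀ {n} (A : Graph n) a b c d → switchAdj A a b c d a b ≡ false
switchAdj-ab A a b c d rewrite dec-true (a ≟ a) refl | dec-true (b ≟ b) refl = refl

switchAdj-cd : ∀ {n} (A : Graph n) a b c d → switchAdj A a b c d c d ≡ false
switchAdj-cd A a b c d
  rewrite dec-true (c ≟ c) refl | dec-true (d ≟ d) refl | ∨-zeroʳ (samePair a b c d) = refl

Distinct4-map : ∀ {m n} {f : Fin m → Fin n} → Injective _≡_ _≡_ f →
  ∀ {a b c d} → Distinct4 a b c d → Distinct4 (f a) (f b) (f c) (f d)
Distinct4-map f-inj (d₁ , d₂ , d₃ , d₄ , d₅ , d₆) =
  d₁ ∘ f-inj , d₂ ∘ f-inj , d₃ ∘ f-inj , d₄ ∘ f-inj , d₅ ∘ f-inj , d₆ ∘ f-inj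

Distinct4-reflect : ∀ {m n} (f : Fin m → Fin n) →
  ∀ {a b c d} → Distinct4 (f a) (f b) (f c) (f d) → Distinct4 a b c d
Distinct4-reflect f (d₁ , d₂ , d₃ , d₄ , d₅ , d₆) =
  d₁ ∘ cong f , d₂ ∘ cong f , d₃ ∘ cong f , d₄ ∘ cong f , d₅ ∘ cong f , d₆ ∘ cong f

module Graft {m n} (H : Graph n) {φ : Fin m → Fin n} (φ-inj : Injective _≡_ _≡_ φ) where

  Outside : Fin n → Fin n → Set
  Outside x y = ¬ Image φ x ⊎ ¬ Image φ y

  image? : ∀ y → Dec (Image φ y)
  image? y = any? λ k → φ k ≟ y

  pairImage? : ∀ x y → (Image φ x × Image φ y) ⊎ Outside x y
  pairImage? x y with image? x | image? y
  ... | yes x∈ | yes y∈ = inj₁ (x∈ , y∈)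
  ... | no x∉ | _ = inj₂ (inj₁ x∉)
  ... | yes _ | no y∉ = inj₂ (inj₂ y∉)

  graftAdj : Graph m → Fin n → Fin n → Bool
  graftAdj R x y with pairImage? x y
  ... | inj₁ ((k , _) , (l , _)) = adj R k l
  ... | inj₂ _ = adj H x y

  graft : Graph m → Graph n
  graft R = tabulate (tabulate ∘ graftAdj R)

  adj-graft-image : ∀ R k l → adj (graft R) (φ k) (φ l) ≡ adj R k l
  adj-graft-image R k l rewrite adj-tabulate (graftAdj R) (φ k) (φ l) with pairImage? (φ k) (φ l)
  ... | inj₁ ((k′ , e) , (l′ , e′)) rewrite φ-inj e | φ-inj e′ = refl
  ... | inj₂ (inj₁ k∉) = ⊥-elim (k∉ (k , refl))
  ... | inj₂ (inj₂ l∉) = ⊥-elim (l∉ (l , refl))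

  adj-graft-outside : ∀ R {x y} → Outside x y → adj (graft R) x y ≡ adj H x y
  adj-graft-outside R {x} {y} out rewrite adj-tabulate (graftAdj R) x y with pairImage? x y
  ... | inj₂ _ = refl
  ... | inj₁ (x∈ , y∈) with out
  ...   | inj₁ x∉ = ⊥-elim (x∉ x∈)
  ...   | inj₂ y∉ = ⊥-elim (y∉ y∈)

  Outside-sym : ∀ {x y} → Outside x y → Outside y x
  Outside-sym (inj₁ x∉) = inj₂ x∉
  Outside-sym (inj₂ y∉) = inj₁ y∉

  graft-isSimple : IsSimple H → ∀ {R} → IsSimple R → IsSimple (graft R)
  graft-isSimple (H-sym , H-loopless) {R} (R-sym , R-loopless) = sym′ , loopless
    where
    sym′ : ∀ x y → adj (graft R) x y ≡ adj (graft R) y x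
    sym′ x y with pairImage? x y
    ... | inj₁ ((k , refl) , (l , refl)) =
      trans (adj-graft-image R k l) (trans (R-sym k l) (sym (adj-graft-image R l k)))
    ... | inj₂ out = trans (adj-graft-outside R out)
      (trans (H-sym x y) (sym (adj-graft-outside R (Outside-sym out))))
    loopless : ∀ x → adj (graft R) x x ≡ false
    loopless x with image? x
    ... | yes (k , refl) = trans (adj-graft-image R k k) (R-loopless k)
    ... | no x∉ = trans (adj-graft-outside R (inj₁ x∉)) (H-loopless x)

  deg-graft-outside : ∀ R {x} → ¬ Image φ x → deg (graft R) x ≡ deg H x
  deg-graft-outside R {x} x∉ = begin
    deg (graft R) x                ≡⟨ deg≡countTrue (graft R) x ⟩
    countTrue (adj (graft R) x)    ≡⟨ countTrue-cong (λ y → adj-graft-outside R {x} {y} (inj₁ x∉)) ⟩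
    countTrue (adj H x)            ≡⟨ deg≡countTrue H x ⟨
    deg H x                        ∎
    where open ≡-Reasoning

  deg-graft-image : ∀ R k →
    deg (graft R) (φ k) + countTrue (adj H (φ k) ∘ φ) ≡ deg H (φ k) + deg R k
  deg-graft-image R k = begin
    deg (graft R) (φ k) + countTrue (adj H (φ k) ∘ φ)
      ≡⟨ cong (_+ _) (deg≡countTrue (graft R) (φ k)) ⟩
    countTrue (adj (graft R) (φ k)) + countTrue (adj H (φ k) ∘ φ)
      ≡⟨ countTrue-agreeOffImage φ-inj (adj (graft R) (φ k)) (adj H (φ k)) (λ y y∉ → adj-graft-outside R (inj₂ y∉)) ⟩
    countTrue (adj H (φ k)) + countTrue (adj (graft R) (φ k) ∘ φ)
      ≡⟨ cong₂ _+_ (sym (deg≡countTrue H (φ k))) (countTrue-cong (adj-graft-image R k)) ⟩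
    deg H (φ k) + countTrue (adj R k)
      ≡⟨ cong (deg H (φ k) +_) (deg≡countTrue R k) ⟨
    deg H (φ k) + deg R k
      ∎
    where open ≡-Reasoning

  graft-isRealization : ∀ {p q} → IsRealization q H →
    (∀ k → countTrue (adj H (φ k) ∘ φ) ≡ lookup p k) →
    ∀ R → IsRealization p R → IsRealization q (graft R)
  graft-isRealization {p} {q} (H-simple , H-deg) onImage R (R-simple , R-deg) =
    graft-isSimple H-simple R-simple , degrees
    where
    degrees : ∀ x → deg (graft R) x ≡ lookup q x
    degrees x with image? x
    ... | no x∉ = trans (deg-graft-outside R x∉) (H-deg x)
    ... | yes (k , refl) = +-cancelʳ-≡ (lookup p k) _ _ (begin
      deg (graft R) (φ k) + lookup p k                   ≡⟨ cong (deg (graft R) (φ k) +_) (onImage k) ⟨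
      deg (graft R) (φ k) + countTrue (adj H (φ k) ∘ φ)  ≡⟨ deg-graft-image R k ⟩
      deg H (φ k) + deg R k                              ≡⟨ cong₂ _+_ (H-deg (φ k)) (R-deg k) ⟩
      lookup q (φ k) + lookup p k                        ∎)
      where open ≡-Reasoning

  graft-injective : ∀ {R S} → graft R ≡ graft S → R ≡ S
  graft-injective {R} {S} eq = graph-ext λ k l →
    trans (sym (adj-graft-image R k l)) (trans (cong (λ A → adj A (φ k) (φ l)) eq) (adj-graft-image S k l))

  graft-differs⇒image : ∀ R S {x y} → adj (graft R) x y ≡ true → adj (graft S) x y ≡ false →
    Image φ x × Image φ y
  graft-differs⇒image R S {x} {y} R-xy S-xy with pairImage? x y
  ... | inj₁ x,y∈ = x,y∈
  ... | inj₂ out with trans (sym R-xy)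
                        (trans (adj-graft-outside R out) (trans (sym (adj-graft-outside S out)) S-xy))
  ...   | ()

  samePair-outside : ∀ a b {x y} → Outside x y → samePair (φ a) (φ b) x y ≡ false
  samePair-outside a b {x} {y} (inj₁ x∉) = samePair-≢ˡ y (λ e → x∉ (a , sym e)) (λ e → x∉ (b , sym e))
  samePair-outside a b {x} {y} (inj₂ y∉) = samePair-≢ʳ x (λ e → y∉ (a , sym e)) (λ e → y∉ (b , sym e))

  switchAdj-graft-image : ∀ R a b c d k l →
    switchAdj (graft R) (φ a) (φ b) (φ c) (φ d) (φ k) (φ l) ≡ switchAdj R a b c d k l
  switchAdj-graft-image R a b c d k l =
    switchAdj-cong (graft R) R (φ a) (φ b) (φ c) (φ d) (φ k) (φ l) a b c d k l
    (samePair-map φ-inj a b k l) (samePair-map φ-inj c d k l)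
    (samePair-map φ-inj a d k l) (samePair-map φ-inj b c k l) (adj-graft-image R k l)

  switchAdj-graft-outside : ∀ R a b c d {x y} → Outside x y →
    switchAdj (graft R) (φ a) (φ b) (φ c) (φ d) x y ≡ adj H x y
  switchAdj-graft-outside R a b c d {x} {y} out = trans
    (switchAdj-away (graft R) (φ a) (φ b) (φ c) (φ d) x y (samePair-outside a b out) (samePair-outside c d out)
                    (samePair-outside a d out) (samePair-outside b c out))
    (adj-graft-outside R out)

  TwoSwitch-graft⁺ : ∀ {R S} → TwoSwitch R S → TwoSwitch (graft R) (graft S)
  TwoSwitch-graft⁺ {R} {S} (a , b , c , d , distinct , ab , cd , ad , bc , switched) =
    φ a , φ b , φ c , φ d , Distinct4-map φ-inj distinct ,
    trans (adj-graft-image R a b) ab , trans (adj-graft-image R c d) cd ,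
    trans (adj-graft-image R a d) ad , trans (adj-graft-image R b c) bc , switched′
    where
    switched′ : ∀ x y → adj (graft S) x y ≡ switchAdj (graft R) (φ a) (φ b) (φ c) (φ d) x y
    switched′ x y with pairImage? x y
    ... | inj₁ ((k , refl) , (l , refl)) =
      trans (adj-graft-image S k l) (trans (switched k l) (sym (switchAdj-graft-image R a b c d k l)))
    ... | inj₂ out = trans (adj-graft-outside S out) (sym (switchAdj-graft-outside R a b c d out))

  -- The removed edges ab and cd differ between graft R and graft S, so a, b, c, d lie in the image.
  TwoSwitch-graft⁻ : ∀ {R S} → TwoSwitch (graft R) (graft S) → TwoSwitch R S
  TwoSwitch-graft⁻ {R} {S} (a , b , c , d , distinct , ab , cd , ad , bc , switched)
    with graft-differs⇒image R S ab (trans (switched a b) (switchAdj-ab (graft R) a b c d))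
       | graft-differs⇒image R S cd (trans (switched c d) (switchAdj-cd (graft R) a b c d))
  ... | (a′ , refl) , (b′ , refl) | (c′ , refl) , (d′ , refl) =
    a′ , b′ , c′ , d′ , Distinct4-reflect φ distinct ,
    trans (sym (adj-graft-image R a′ b′)) ab , trans (sym (adj-graft-image R c′ d′)) cd ,
    trans (sym (adj-graft-image R a′ d′)) ad , trans (sym (adj-graft-image R b′ c′)) bc ,
    λ k l → trans (sym (adj-graft-image S k l))
      (trans (switched (φ k) (φ l)) (switchAdj-graft-image R a′ b′ c′ d′ k l))

lemma4p2 : ∀ {m n} (p : Vec ℕ m) (q : Vec ℕ n) →
    (∃[ G ] ∃[ H ] (IsRealization p G × IsRealization q H × InducedSubgraphOf G H)) →
    RGInducedSubgraphOf p q
lemma4p2 p q (G , H , G-real , H-real , φ , φ-inj , embeds) =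
  F , (λ R S → graft-injective {proj₁ R} {proj₁ S}) ,
  λ R S → mk⇔ (Sum.map TwoSwitch-graft⁺ TwoSwitch-graft⁺) (Sum.map TwoSwitch-graft⁻ TwoSwitch-graft⁻)
  where
  open Graft H (λ {i} {j} → φ-inj i j)

  onImage : ∀ k → countTrue (adj H (φ k) ∘ φ) ≡ lookup p k
  onImage k = trans (sym (deg-embedding G H φ embeds k)) (proj₂ G-real k)

  F : Realization p → Realization q
  F (R , R-real) = graft R , graft-isRealization {p} {q} H-real onImage R R-real
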